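{- Let $n \ge 3$ be an integer and $S_n = \{1, \ldots, n\}$. Let $p_1, \ldots, p_n$ be pairwise distinct primes, let $v_1, \ldots, v_n$ be positive integers, and let $\mathcal D$ be a subcollection of $\mathcal P_\star(S_n)$ such that $\mathcal D_0 \subseteq \mathcal D$, where $$\mathcal D_0 := \mathcal P_1(S_n) \cup \mathcal P_{n-2}(S_n) \cup \mathcal P_{n-1}(S_n).$$ Then, for every function $\varepsilon: \mathcal P_\star(S_n) \to \{\pm 1\}$ whose restriction to $\mathcal D_0$ is constant, there exists at least one prime $q \notin \{p_1, \ldots, p_n\}$ such that $q$ divides $\prod_{i \in I} p_i^{v_i} - \varepsilon(I)$ for some $I \in \mathcal D$.
   Context: For a set $X$, $\mathcal P_\star(X)$ denotes the family of all finite nonempty proper subsets of $X$ (so $\emptyset, X \notin \mathcal P_\star(X)$), and for an integer $k \ge 1$, $\mathcal P_k(X)$ denotes the family of all subsets of $X$ with exactly $k$ elements. -}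

module Defs where

open import Data.Nat using (ℕ; _*_; _^_; _∸_; _<_; _≡ᵇ_)
open import Data.Bool using (true; false)
open import Data.Vec using ([]; _∷_)
open import Data.Fin using (Fin; zero; suc)
open import Data.Fin.Subset using (Subset; Nonempty; ⊤; ∣_∣)
open import Data.Product using (_×_)
open import Data.Sum using (_⊎_)
open import Relation.Binary.PropositionalEquality using (_≡_; _≢_)
open import Function using (_∘_)

prodOver : ∀ {n} → Subset n → (Fin n → ℕ) → ℕ
prodOver [] f = 1
prodOver (true ∷ I) f = f zero * prodOver I (f ∘ suc)
prodOver (false ∷ I) f = prodOver I (f ∘ suc)

Pstar : ∀ {n} → Subset n → Set
Pstar I = Nonempty I × I ≢ ⊤

Pk : ∀ {n} → ℕ → Subset n → Set
Pk k I = ∣ I ∣ ≡ k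

D0 : ∀ {n} → Subset n → Set
D0 {n} I = Pk 1 I ⊎ Pk (n ∸ 2) I ⊎ Pk (n ∸ 1) I

module Submission where

-- Suppose not. For I ∈ 𝒟₀, every prime factor of shift s (N I) = |N I - s| is then a p i with
-- i ∉ I: I is "exceptional". Take distinct i, j and Q = N (⊤ - i - j). Then |a j Q - s| is a
-- power of p i, |a i Q - s| one of p j, and |Q - s| has only the prime factors p i, p j; comparing
-- prime powers by size, |Q - s| divides |a j Q - s| * |a i Q - s| ≡ (a i - 1)(a j - 1) modulo
-- |Q - s|, which forces Q < a i * a j (pairBound).
--   n ≥ 4:  a₀a₁ ≤ N (⊤ - 2 - 3) < a₂a₃ ≤ N (⊤ - 0 - 1) < a₀a₁, a contradiction.
--   n = 3:  a i < a j * a k, so the p i-power |a j a k - s| is divisible by a i; the coprime a i then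
--           all divide |a₀a₁ + a₀a₂ + a₁a₂ - s|, leaving a few small triples, excluded by computation.

open import Defs
open import Data.Nat using (ℕ; _+_; _≤_; _<_; _^_)
open import Data.Nat.Primality using (Prime)
open import Data.Fin using (Fin)
open import Data.Fin.Subset using (Subset)
open import Data.Sign using (Sign)
open import Data.Product using (∃; _×_)
open import Function.Definitions using (Injective)
open import Relation.Binary.PropositionalEquality using (_≡_; _≢_)

module PrimeFactors where

  open import Data.Nat
  open import Data.Nat.Properties
  open import Data.Nat.Divisibility
  open import Data.Nat.Primality
  open import Data.Nat.Coprimality using (Coprime; coprime-divisor)
  import Data.Nat.Coprimality as Coprimality
  open import Data.Nat.Primality.Factorisation using (factorise)
  open import Data.Nat.Induction using (<-wellFounded)
  open import Data.Nat.Tactic.RingSolver using (solve-∀)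
  open import Induction.WellFounded using (Acc; acc)
  open import Data.List using ([]; _∷_)
  open import Data.Nat.ListAction using (product)
  open import Data.List.Relation.Unary.All using (_∷_)
  open import Data.Product using (∃; ∃₂; _×_; _,_)
  open import Data.Sum using (_⊎_; inj₁; inj₂)
  open import Data.Empty using (⊥; ⊥-elim)
  open import Function using (_∘_)
  open import Relation.Nullary using (¬_; Dec; yes; no)
  open import Relation.Nullary.Decidable using (_×-dec_; ¬?)
  open import Data.Fin using (Fin; toℕ; fromℕ<)
  open import Data.Fin.Properties using (any?; toℕ-fromℕ<)
  open import Relation.Binary.PropositionalEquality

  PrimeFactorsIn : (ℕ → Set) → ℕ → Set
  PrimeFactorsIn P m = ∀ q → Prime q → q ∣ m → P q

  prime≥2 : ∀ {p} → Prime p → 2 ≤ p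
  prime≥2 {p} pr = nonTrivial⇒n>1 p {{prime⇒nonTrivial pr}}

  prime∤1 : ∀ {q} → Prime q → ¬ q ∣ 1
  prime∤1 pq d = <⇒≢ (prime≥2 pq) (sym (∣1⇒≡1 d))

  primeFactor : ∀ m → 2 ≤ m → ∃ λ q → Prime q × q ∣ m
  primeFactor m@(suc _) 2≤m with factorise m
  ... | record { factors = [] ; isFactorisation = m≡1 } = ⊥-elim (<⇒≢ 2≤m (sym m≡1))
  ... | record { factors = q ∷ qs ; isFactorisation = m≡q*qs ; factorsPrime = prime-q ∷ _ } =
    q , prime-q , divides (product qs) (trans m≡q*qs (*-comm q (product qs)))

  prime∣prime-power : ∀ {q p} v → Prime q → Prime p → q ∣ p ^ v → q ≡ p
  prime∣prime-power zero prime-q _ q∣1 = ⊥-elim (prime∤1 prime-q q∣1)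
  prime∣prime-power {q} {p} (suc v) prime-q prime-p q∣p^v+1
    with euclidsLemma p (p ^ v) prime-q q∣p^v+1
  ... | inj₂ q∣p^v = prime∣prime-power v prime-q prime-p q∣p^v
  ... | inj₁ q∣p with prime⇒irreducible prime-p q∣p
  ...   | inj₁ q≡1 = ⊥-elim (<⇒≢ (prime≥2 prime-q) (sym q≡1))
  ...   | inj₂ q≡p = q≡p

  twoPrimePowers : ∀ {p r} g → 1 ≤ g → PrimeFactorsIn (λ q → q ≡ p ⊎ q ≡ r) g →
    ∃₂ λ e f → g ≡ p ^ e * r ^ f
  twoPrimePowers {p} {r} g = go g (<-wellFounded g)
    where
    go : ∀ g → Acc _<_ g → 1 ≤ g → PrimeFactorsIn (λ q → q ≡ p ⊎ q ≡ r) g →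
      ∃₂ λ e f → g ≡ p ^ e * r ^ f
    go g (acc smaller) 1≤g factors-g with g ≟ 1
    ... | yes refl = 0 , 0 , refl
    ... | no g≢1 with primeFactor g (≤∧≢⇒< 1≤g (g≢1 ∘ sym))
    ... | q , prime-q , q∣g@(divides g′ g≡g′*q) = peel (factors-g q prime-q q∣g) (go g′ (smaller g′<g) 1≤g′ factors-g′)
      where
      instance
        _ = prime⇒nonTrivial prime-q
        _ = >-nonZero 1≤g
      g′<g : g′ < g
      g′<g = quotient-< q∣g
      1≤g′ : 1 ≤ g′
      1≤g′ = >-nonZero⁻¹ g′ {{quotient≢0 q∣g}}
      factors-g′ : PrimeFactorsIn (λ q → q ≡ p ⊎ q ≡ r) g′
      factors-g′ t prime-t t∣g′ = factors-g t prime-t (∣-trans t∣g′ (quotient-∣ q∣g))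
      peel : q ≡ p ⊎ q ≡ r → ∃₂ (λ e f → g′ ≡ p ^ e * r ^ f) → ∃₂ λ e f → g ≡ p ^ e * r ^ f
      peel (inj₁ refl) (e , f , refl) = suc e , f , trans g≡g′*q (rotate (p ^ e) (r ^ f) q)
        where
        rotate : ∀ x y z → x * y * z ≡ z * x * y
        rotate = solve-∀
      peel (inj₂ refl) (e , f , refl) = e , suc f , trans g≡g′*q (rotate (p ^ e) (r ^ f) q)
        where
        rotate : ∀ x y z → x * y * z ≡ x * (z * y)
        rotate = solve-∀

  primePower : ∀ {p} M → 1 ≤ M → PrimeFactorsIn (_≡ p) M → ∃ λ k → M ≡ p ^ k
  primePower {p} M 1≤M factors-M with twoPrimePowers {p} {p} M 1≤M (λ q prime-q q∣M → inj₁ (factors-M q prime-q q∣M))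
  ... | e , f , M≡p^e*p^f = e + f , trans M≡p^e*p^f (sym (^-distribˡ-+-* p e f))

  ^-≤⇒∣ : ∀ {p} e k → 2 ≤ p → p ^ e ≤ p ^ k → p ^ e ∣ p ^ k
  ^-≤⇒∣ {p} e k 2≤p p^e≤p^k with e ≤? k
  ... | yes e≤k = divides (p ^ (k ∸ e)) (trans (cong (p ^_) (sym (m∸n+n≡m e≤k))) (^-distribˡ-+-* p (k ∸ e) e))
  ... | no e≰k = ⊥-elim (<⇒≱ (^-monoʳ-< p 2≤p (≰⇒> e≰k)) p^e≤p^k)

  prime-power-≤⇒∣ : ∀ {p M} v → Prime p → 1 ≤ M → PrimeFactorsIn (_≡ p) M → p ^ v ≤ M → p ^ v ∣ M
  prime-power-≤⇒∣ {p} {M} v prime-p 1≤M factors-M p^v≤M with primePower M 1≤M factors-M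
  ... | k , refl = ^-≤⇒∣ v k (prime≥2 prime-p) p^v≤M

  -- If g's prime factors are among p and r, every prime factor of A is p, every prime factor
  -- of B is r, and g ≤ A, g ≤ B, then g ∣ A * B: split g = p ^ e * r ^ f and compare each part.
  twoPrime∣product : ∀ {p r g A B} → Prime p → Prime r → 1 ≤ g →
    PrimeFactorsIn (λ q → q ≡ p ⊎ q ≡ r) g → PrimeFactorsIn (_≡ p) A → PrimeFactorsIn (_≡ r) B →
    g ≤ A → g ≤ B → g ∣ A * B
  twoPrime∣product {p} {r} {g} prime-p prime-r 1≤g factors-g factors-A factors-B g≤A g≤B
    with twoPrimePowers g 1≤g factors-g
  ... | e , f , refl = *-pres-∣
    (prime-power-≤⇒∣ e prime-p (≤-trans 1≤g g≤A) factors-A (≤-trans (m≤m*n (p ^ e) (r ^ f)) g≤A))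
    (prime-power-≤⇒∣ f prime-r (≤-trans 1≤g g≤B) factors-B (≤-trans (m≤n*m (r ^ f) (p ^ e)) g≤B))
    where
    instance
      _ = m^n≢0 p e {{prime⇒nonZero prime-p}}
      _ = m^n≢0 r f {{prime⇒nonZero prime-r}}

  module _ {n} (p : Fin n → ℕ) where

    private
      NewFactor : ℕ → ℕ → Set
      NewFactor m q = Prime q × ¬ (∃ λ i → q ≡ p i) × q ∣ m

      newFactor? : ∀ m q → Dec (NewFactor m q)
      newFactor? m q = prime? q ×-dec ¬? (any? λ i → q ≟ p i) ×-dec q ∣? m

    newPrimeFactor? : ∀ m → 1 ≤ m →
      (∃ λ q → Prime q × (∀ i → q ≢ p i) × q ∣ m) ⊎ PrimeFactorsIn (λ q → ∃ λ i → q ≡ p i) m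
    newPrimeFactor? m 1≤m with any? {n = suc m} (λ k → newFactor? m (toℕ k))
    ... | yes (k , prime-k , k∉p , k∣m) = inj₁ (toℕ k , prime-k , (λ i k≡pi → k∉p (i , k≡pi)) , k∣m)
    ... | no none = inj₂ oldFactor
      where
      oldFactor : PrimeFactorsIn (λ q → ∃ λ i → q ≡ p i) m
      oldFactor q prime-q q∣m with any? (λ i → q ≟ p i)
      ... | yes q∈p = q∈p
      ... | no q∉p = ⊥-elim (none (fromℕ< q<1+m , subst (NewFactor m) (sym (toℕ-fromℕ< q<1+m)) (prime-q , q∉p , q∣m)))
        where
        q<1+m : q < suc m
        q<1+m = s≤s (∣⇒≤ {{>-nonZero 1≤m}} q∣m)

  positive-divisor : ∀ {d m} → 1 ≤ m → d ∣ m → 1 ≤ d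
  positive-divisor {suc _} _ _ = s≤s z≤n
  positive-divisor {zero} 1≤m 0∣m = ⊥-elim (<⇒≢ 1≤m (sym (0∣⇒≡0 0∣m)))

  noCommonPrime⇒coprime : ∀ {m n} → 1 ≤ m → (∀ q → Prime q → q ∣ m → q ∣ n → ⊥) → Coprime m n
  noCommonPrime⇒coprime {m} 1≤m noCommon {d} (d∣m , d∣n) with d ≟ 1
  ... | yes d≡1 = d≡1
  ... | no d≢1 with primeFactor d (≤∧≢⇒< (positive-divisor 1≤m d∣m) (d≢1 ∘ sym))
  ... | q , prime-q , q∣d = ⊥-elim (noCommon q prime-q (∣-trans q∣d d∣m) (∣-trans q∣d d∣n))

  coprime-∣⇒*∣ : ∀ {m n X} → Coprime m n → m ∣ X → n ∣ X → m * n ∣ X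
  coprime-∣⇒*∣ {m} {n} coprime (divides t X≡t*m) n∣X =
    subst (m * n ∣_) (trans (*-comm m t) (sym X≡t*m))
      (*-monoʳ-∣ m (coprime-divisor (Coprimality.sym coprime) (subst (n ∣_) (trans X≡t*m (*-comm t m)) n∣X)))

module SignShift where

  open import Data.Nat
  open import Data.Nat.Properties
  open import Data.Nat.Divisibility
  open import Data.Nat.Primality using (Prime)
  open import Data.Nat.Tactic.RingSolver using (solve-∀)
  open import Data.Sign using (Sign)
  import Data.Sign as Sign
  open import Data.Integer as ℤ using (+_; _◃_)
  open import Data.Sum using (_⊎_)
  open import Relation.Binary.PropositionalEquality
  open PrimeFactors

  -- shift s N is the absolute value of N - s, where the sign s is read as ±1.
  shift : Sign → ℕ → ℕ
  shift Sign.+ N = N ∸ 1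
  shift Sign.- N = suc N

  ∣-∣≡shift : ∀ s N → 1 ≤ N → ℤ.∣ + N ℤ.- (s ◃ 1) ∣ ≡ shift s N
  ∣-∣≡shift Sign.+ (suc N) _ = refl
  ∣-∣≡shift Sign.- N _ = +-comm N 1

  shift≥1 : ∀ s {N} → 2 ≤ N → 1 ≤ shift s N
  shift≥1 Sign.+ (s≤s (s≤s _)) = s≤s z≤n
  shift≥1 Sign.- _ = s≤s z≤n

  shift-mono : ∀ s {M N} → M ≤ N → shift s M ≤ shift s N
  shift-mono Sign.+ M≤N = ∸-monoˡ-≤ 1 M≤N
  shift-mono Sign.- M≤N = s≤s M≤N

  ∸1≤shift : ∀ s N → N ∸ 1 ≤ shift s N
  ∸1≤shift Sign.+ N = ≤-refl
  ∸1≤shift Sign.- N = ≤-trans (m∸n≤m N 1) (n≤1+n N)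

  shift≤suc : ∀ s N → shift s N ≤ suc N
  shift≤suc Sign.+ N = ≤-trans (m∸n≤m N 1) (n≤1+n N)
  shift≤suc Sign.- N = ≤-refl

  shift-+ : ∀ s m {k} → 1 ≤ k → shift s (m + k) ≡ m + shift s k
  shift-+ Sign.+ m 1≤k = +-∸-assoc m 1≤k
  shift-+ Sign.- m _ = sym (+-suc m _)

  ∣shift⇒∣shift-+ : ∀ s {x m} t → 1 ≤ m → x ∣ shift s m → x ∣ shift s (x * t + m)
  ∣shift⇒∣shift-+ s {x} t 1≤m x∣shift = subst (x ∣_) (sym (shift-+ s (x * t) 1≤m)) (∣m∣n⇒∣m+n (m∣m*n t) x∣shift)

  ∣-∧-∣shift⇒∣1 : ∀ s {q N} → 1 ≤ N → q ∣ N → q ∣ shift s N → q ∣ 1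
  ∣-∧-∣shift⇒∣1 Sign.+ {q} {suc N} _ q∣N q∣N∸1 = ∣m+n∣m⇒∣n (subst (q ∣_) (+-comm 1 N) q∣N) q∣N∸1
  ∣-∧-∣shift⇒∣1 Sign.- {q} {N} _ q∣N q∣N+1 = ∣m+n∣m⇒∣n (subst (q ∣_) (+-comm 1 N) q∣N+1) q∣N

  -- Modulo shift s Q we have Q ≡ s, hence shift s ((1 + α) * Q) ≡ ± α and the product of two
  -- such numbers is ≡ α * β.
  shift-multiples : ∀ s α β Q → 1 ≤ Q →
    shift s Q ∣ shift s (suc α * Q) * shift s (suc β * Q) → shift s Q ∣ α * β
  shift-multiples Sign.+ α β (suc g) _ g∣product =
    ∣m+n∣m⇒∣n (subst (g ∣_) (expand g α β) g∣product) (m∣m*n _)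
    where
    expand : ∀ g α β → (g + α * suc g) * (g + β * suc g) ≡ g * ((1 + α) * (g + β * suc g) + α * (1 + β)) + α * β
    expand = solve-∀
  shift-multiples Sign.- α β Q _ Q+1∣product =
    ∣m+n∣m⇒∣n (subst (suc Q ∣_) (expand Q α β) (∣m∣n⇒∣m+n Q+1∣product (∣n⇒∣m*n α (n∣m*n (1 + β)))))
              (∣m⇒∣m*n _ (n∣m*n (1 + α)))
    where
    expand : ∀ Q α β → suc (Q + α * Q) * suc (Q + β * Q) + α * ((1 + β) * suc Q) ≡ ((1 + α) * suc Q) * suc (Q + β * Q) + α * β
    expand = solve-∀

  -- Then shift s Q divides shift s (y * Q) * shift s (x * Q), hence (x - 1) * (y - 1); so Q < x * y.
  pairBound : ∀ s {p r x y Q} → Prime p → Prime r → 2 ≤ x → 2 ≤ y → 2 ≤ Q →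
    PrimeFactorsIn (_≡ p) (shift s (y * Q)) → PrimeFactorsIn (_≡ r) (shift s (x * Q)) →
    PrimeFactorsIn (λ q → q ≡ p ⊎ q ≡ r) (shift s Q) → Q < x * y
  pairBound s {x = suc α} {y = suc β} {Q} prime-p prime-r (s≤s 1≤α) (s≤s 1≤β) 2≤Q factors-yQ factors-xQ factors-Q =
    begin-strict
      Q                   ≤⟨ m≤n+m∸n Q 1 ⟩
      1 + (Q ∸ 1)         ≤⟨ +-monoʳ-≤ 1 (≤-trans (∸1≤shift s Q) (∣⇒≤ shiftQ∣βα)) ⟩
      1 + β * α           <⟨ +-monoˡ-≤ (1 + β * α) (≤-trans 1≤α (m≤m+n α β)) ⟩
      α + β + (1 + β * α) ≡⟨ expand α β ⟨
      suc α * suc β       ∎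
    where
    open ≤-Reasoning
    instance _ = >-nonZero (*-mono-≤ 1≤β 1≤α)
    shiftQ∣product : shift s Q ∣ shift s (suc β * Q) * shift s (suc α * Q)
    shiftQ∣product = twoPrime∣product prime-p prime-r (shift≥1 s 2≤Q) factors-Q factors-yQ factors-xQ
      (shift-mono s (m≤n*m Q (suc β))) (shift-mono s (m≤n*m Q (suc α)))
    shiftQ∣βα : shift s Q ∣ β * α
    shiftQ∣βα = shift-multiples s β α Q (≤-trans (s≤s z≤n) 2≤Q) shiftQ∣product
    expand : ∀ α β → suc α * suc β ≡ α + β + (1 + β * α)
    expand = solve-∀

module SubsetProducts where

  open import Data.Nat hiding (∣_-_∣)
  open import Data.Nat.Properties
  open import Data.Nat.Divisibility using (_∣_; m∣m*n)
  open import Data.Nat.Tactic.RingSolver using (solve-∀)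
  open import Data.Fin using (Fin; zero; suc)
  import Data.Fin as Fin
  open import Data.Fin.Subset using (Subset; inside; outside; ⊤; _∈_; _∉_; _-_; ∣_∣)
  open import Data.Fin.Subset.Properties using (p─⊥≡p; x∈p∧x≢y⇒x∈p-y; ∈⊤; ∣⊤∣≡n)
  open import Data.Vec using ([]; _∷_; here; there)
  open import Data.Empty using (⊥-elim)
  open import Relation.Nullary using (yes; no)
  open import Function using (_∘_)
  open import Relation.Binary.PropositionalEquality

  prodOver-remove : ∀ {n} {p : Subset n} {x} (f : Fin n → ℕ) → x ∈ p →
    prodOver p f ≡ f x * prodOver (p - x) f
  prodOver-remove {p = inside ∷ p} f here = cong (f zero *_) (cong (λ r → prodOver r (f ∘ suc)) (sym (p─⊥≡p p)))
  prodOver-remove {p = outside ∷ p} f (there x∈p) = prodOver-remove (f ∘ suc) x∈p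
  prodOver-remove {p = inside ∷ p} {suc x} f (there x∈p) = begin
    f zero * prodOver p (f ∘ suc)                       ≡⟨ cong (f zero *_) (prodOver-remove (f ∘ suc) x∈p) ⟩
    f zero * (f (suc x) * prodOver (p - x) (f ∘ suc))   ≡⟨ swap (f zero) (f (suc x)) _ ⟩
    f (suc x) * (f zero * prodOver (p - x) (f ∘ suc))   ∎
    where
    open ≡-Reasoning
    swap : ∀ a b c → a * (b * c) ≡ b * (a * c)
    swap = solve-∀

  ∣-remove∣ : ∀ {n} {p : Subset n} {x} → x ∈ p → ∣ p ∣ ≡ suc ∣ p - x ∣
  ∣-remove∣ {p = inside ∷ p} here = cong (suc ∘ ∣_∣) (sym (p─⊥≡p p))
  ∣-remove∣ {p = outside ∷ p} (there x∈p) = ∣-remove∣ x∈p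
  ∣-remove∣ {p = inside ∷ p} (there x∈p) = cong suc (∣-remove∣ x∈p)

  prodOver≥1 : ∀ {n} (p : Subset n) (f : Fin n → ℕ) → (∀ i → 1 ≤ f i) → 1 ≤ prodOver p f
  prodOver≥1 [] f f≥1 = ≤-refl
  prodOver≥1 (inside ∷ p) f f≥1 = *-mono-≤ (f≥1 zero) (prodOver≥1 p (f ∘ suc) (f≥1 ∘ suc))
  prodOver≥1 (outside ∷ p) f f≥1 = prodOver≥1 p (f ∘ suc) (f≥1 ∘ suc)

  module _ {n} (f : Fin n → ℕ) (f≥1 : ∀ i → 1 ≤ f i) where

    ∈⇒≤prodOver : ∀ {p x} → x ∈ p → f x ≤ prodOver p f
    ∈⇒≤prodOver {p} {x} x∈p = begin
      f x                       ≤⟨ m≤m*n (f x) _ {{>-nonZero (prodOver≥1 (p - x) f f≥1)}} ⟩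
      f x * prodOver (p - x) f  ≡⟨ prodOver-remove f x∈p ⟨
      prodOver p f              ∎
      where open ≤-Reasoning

    ∈∈⇒≤prodOver : ∀ {p x y} → x ∈ p → y ∈ p → x ≢ y → f x * f y ≤ prodOver p f
    ∈∈⇒≤prodOver {p} {x} {y} x∈p y∈p x≢y = begin
      f x * f y                 ≤⟨ *-monoʳ-≤ (f x) (∈⇒≤prodOver (x∈p∧x≢y⇒x∈p-y y∈p (x≢y ∘ sym))) ⟩
      f x * prodOver (p - x) f  ≡⟨ prodOver-remove f x∈p ⟨
      prodOver p f              ∎
      where open ≤-Reasoning

  ∉-remove : ∀ {n} {p : Subset n} {x y} → x ∈ p → x ∉ p - y → x ≡ y
  ∉-remove {x = x} {y} x∈p x∉p-y with x Fin.≟ y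
  ... | yes x≡y = x≡y
  ... | no x≢y = ⊥-elim (x∉p-y (x∈p∧x≢y⇒x∈p-y x∈p x≢y))

  ∈⇒∣prodOver : ∀ {n} {p : Subset n} {x} (f : Fin n → ℕ) → x ∈ p → f x ∣ prodOver p f
  ∈⇒∣prodOver f x∈p = subst (f _ ∣_) (sym (prodOver-remove f x∈p)) (m∣m*n _)

  ∣⊤-i∣ : ∀ {n} (i : Fin n) → ∣ ⊤ - i ∣ ≡ n ∸ 1
  ∣⊤-i∣ {n} i = cong (_∸ 1) (trans (sym (∣-remove∣ (∈⊤ {x = i}))) (∣⊤∣≡n n))

  ∣⊤-i-j∣ : ∀ {n} {i j : Fin n} → i ≢ j → ∣ ⊤ - i - j ∣ ≡ n ∸ 2
  ∣⊤-i-j∣ {n} {i} {j} i≢j = cong (_∸ 2) (trans (sym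
    (trans (∣-remove∣ (∈⊤ {x = i})) (cong suc (∣-remove∣ (x∈p∧x≢y⇒x∈p-y ∈⊤ (i≢j ∘ sym)))))) (∣⊤∣≡n n))

-- The arithmetic endgame of the case n = 3, for plain numbers x, y, z.
module ThreeNumbers where

  open import Data.Nat
  open import Data.Nat.Properties
  open import Data.Nat.Divisibility
  open import Data.Nat.Primality using (prime?)
  open import Data.Nat.Coprimality using (Coprime)
  open import Data.Nat.Tactic.RingSolver using (solve-∀)
  open import Data.Sign using (Sign)
  import Data.Sign as Sign
  open import Data.Empty using (⊥)
  open import Relation.Nullary using (¬_; contradiction; yes; no)
  open import Data.Sum using (inj₁; inj₂)
  open import Function using (_∘_)
  open import Relation.Nullary.Decidable using (from-yes; from-no)
  open import Relation.Binary.Definitions using (tri<; tri≈; tri>)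
  open import Relation.Binary.PropositionalEquality
  open PrimeFactors
  open SignShift

  -- The constraints that the case n = 3 of the theorem imposes on a₀, a₁, a₂ (for the sign s):
  -- x * y * z divides shift s (x * y + x * z + y * z), and each of x, y, z is divisible by every
  -- prime factor of the shift of the product of the other two.
  record Triple (s : Sign) (x y z : ℕ) : Set where
    field
      product∣ : x * y * z ∣ shift s (x * y + x * z + y * z)
      factors-x : PrimeFactorsIn (_∣ x) (shift s (y * z))
      factors-y : PrimeFactorsIn (_∣ y) (shift s (x * z))
      factors-z : PrimeFactorsIn (_∣ z) (shift s (x * y))

  swap₁₂ : ∀ {s x y z} → Triple s x y z → Triple s y x z
  swap₁₂ {s} {x} {y} {z} t = record
    { product∣ = subst₂ (λ m S → m ∣ shift s S) (*-comm₃ x y z) (e₂-comm x y z) product∣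
    ; factors-x = factors-y
    ; factors-y = factors-x
    ; factors-z = subst (λ m → PrimeFactorsIn (_∣ z) (shift s m)) (*-comm x y) factors-z
    }
    where
    open Triple t
    *-comm₃ : ∀ x y z → x * y * z ≡ y * x * z
    *-comm₃ = solve-∀
    e₂-comm : ∀ x y z → x * y + x * z + y * z ≡ y * x + y * z + x * z
    e₂-comm = solve-∀

  swap₂₃ : ∀ {s x y z} → Triple s x y z → Triple s x z y
  swap₂₃ {s} {x} {y} {z} t = record
    { product∣ = subst₂ (λ m S → m ∣ shift s S) (*-comm₃ x y z) (e₂-comm x y z) product∣
    ; factors-x = subst (λ m → PrimeFactorsIn (_∣ x) (shift s m)) (*-comm y z) factors-x
    ; factors-y = factors-z
    ; factors-z = factors-y
    }
    where
    open Triple t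
    *-comm₃ : ∀ x y z → x * y * z ≡ x * z * y
    *-comm₃ = solve-∀
    e₂-comm : ∀ x y z → x * y + x * z + y * z ≡ x * z + x * y + z * y
    e₂-comm = solve-∀

  product∣shift-e₂ : ∀ s {x y z} → 1 ≤ x → 1 ≤ y → 1 ≤ z → Coprime x y → Coprime (x * y) z →
    x ∣ shift s (y * z) → y ∣ shift s (x * z) → z ∣ shift s (x * y) →
    x * y * z ∣ shift s (x * y + x * z + y * z)
  product∣shift-e₂ s {x} {y} {z} 1≤x 1≤y 1≤z coprime-xy coprime-xy-z x∣ y∣ z∣ =
    coprime-∣⇒*∣ coprime-xy-z (coprime-∣⇒*∣ coprime-xy
      (subst (λ S → x ∣ shift s S) (sym (e₂-x x y z)) (∣shift⇒∣shift-+ s (y + z) (*-mono-≤ 1≤y 1≤z) x∣))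
      (subst (λ S → y ∣ shift s S) (sym (e₂-y x y z)) (∣shift⇒∣shift-+ s (x + z) (*-mono-≤ 1≤x 1≤z) y∣)))
      (subst (λ S → z ∣ shift s S) (sym (e₂-z x y z)) (∣shift⇒∣shift-+ s (x + y) (*-mono-≤ 1≤x 1≤y) z∣))
    where
    e₂-x : ∀ x y z → x * y + x * z + y * z ≡ x * (y + z) + y * z
    e₂-x = solve-∀
    e₂-y : ∀ x y z → x * y + x * z + y * z ≡ y * (x + z) + x * z
    e₂-y = solve-∀
    e₂-z : ∀ x y z → x * y + x * z + y * z ≡ z * (x + y) + x * y
    e₂-z = solve-∀

  sort₃ : (P : ℕ → ℕ → ℕ → Set) → (∀ {x y z} → P x y z → P y x z) → (∀ {x y z} → P x y z → P x z y) →
    (∀ {x y z} → x < y → y < z → P x y z) → ∀ {x y z} → x ≢ y → y ≢ z → x ≢ z → P x y z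
  sort₃ P swap₁₂ swap₂₃ sorted {x} {y} {z} x≢y y≢z x≢z with <-cmp x y | <-cmp y z | <-cmp x z
  ... | tri≈ _ x≡y _ | _ | _ = contradiction x≡y x≢y
  ... | _ | tri≈ _ y≡z _ | _ = contradiction y≡z y≢z
  ... | _ | _ | tri≈ _ x≡z _ = contradiction x≡z x≢z
  ... | tri< x<y _ _ | tri< y<z _ _ | _ = sorted x<y y<z
  ... | tri< x<y _ _ | tri> _ _ z<y | tri< x<z _ _ = swap₂₃ (sorted x<z z<y)
  ... | tri< x<y _ _ | tri> _ _ z<y | tri> _ _ z<x = swap₂₃ (swap₁₂ (sorted z<x x<y))
  ... | tri> _ _ y<x | tri< y<z _ _ | tri< x<z _ _ = swap₁₂ (sorted y<x x<z)
  ... | tri> _ _ y<x | tri< y<z _ _ | tri> _ _ z<x = swap₁₂ (swap₂₃ (sorted y<z z<x))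
  ... | tri> _ _ y<x | tri> _ _ z<y | _ = swap₁₂ (swap₂₃ (swap₁₂ (sorted z<y y<x)))

  e₂+1<product-3≤x : ∀ {x y z} → 3 ≤ x → x < y → y < z → suc (x * y + x * z + y * z) < x * y * z
  e₂+1<product-3≤x {x} {y} {z} 3≤x x<y y<z = begin
    2 + (x * y + x * z + y * z)      ≡⟨ regroup x y z ⟩
    suc (x * y) + suc (x * z) + y * z ≤⟨ +-monoˡ-≤ (y * z) (+-mono-≤ xy<yz xz<yz) ⟩
    y * z + y * z + y * z            ≡⟨ triple (y * z) ⟩
    3 * (y * z)                      ≤⟨ *-monoˡ-≤ (y * z) 3≤x ⟩
    x * (y * z)                      ≡⟨ *-assoc x y z ⟨
    x * y * z                        ∎
    where
    open ≤-Reasoning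
    instance
      _ = >-nonZero (≤-trans (s≤s z≤n) x<y)
      _ = >-nonZero (≤-trans (s≤s z≤n) (<-trans x<y y<z))
    xy<yz : x * y < y * z
    xy<yz = subst (x * y <_) (*-comm z y) (*-monoˡ-< y (<-trans x<y y<z))
    xz<yz : x * z < y * z
    xz<yz = *-monoˡ-< z x<y
    regroup : ∀ x y z → 2 + (x * y + x * z + y * z) ≡ suc (x * y) + suc (x * z) + y * z
    regroup = solve-∀
    triple : ∀ m → m + m + m ≡ 3 * m
    triple = solve-∀

  e₂+1<product-4≤y : ∀ {y z} → 4 ≤ y → y < z → suc (2 * y + 2 * z + y * z) < 2 * y * z
  e₂+1<product-4≤y {y} {z} 4≤y y<z = begin
    2 + (2 * y + 2 * z + y * z) ≡⟨ regroup y z ⟩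
    2 * suc y + 2 * z + y * z   ≤⟨ +-monoˡ-≤ (y * z) (+-monoˡ-≤ (2 * z) (*-monoʳ-≤ 2 y<z)) ⟩
    2 * z + 2 * z + y * z       ≡⟨ regroup′ y z ⟩
    4 * z + y * z               ≤⟨ +-monoˡ-≤ (y * z) (*-monoˡ-≤ z 4≤y) ⟩
    y * z + y * z               ≡⟨ regroup″ y z ⟩
    2 * y * z                   ∎
    where
    open ≤-Reasoning
    regroup : ∀ y z → 2 + (2 * y + 2 * z + y * z) ≡ 2 * suc y + 2 * z + y * z
    regroup = solve-∀
    regroup′ : ∀ y z → 2 * z + 2 * z + y * z ≡ 4 * z + y * z
    regroup′ = solve-∀
    regroup″ : ∀ y z → y * z + y * z ≡ 2 * y * z
    regroup″ = solve-∀

  e₂+1<product-8≤z : ∀ {z} → 8 ≤ z → suc (2 * 3 + 2 * z + 3 * z) < 2 * 3 * z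
  e₂+1<product-8≤z {z} 8≤z = begin
    2 + (2 * 3 + 2 * z + 3 * z) ≡⟨ regroup z ⟩
    8 + 5 * z                   ≤⟨ +-monoˡ-≤ (5 * z) 8≤z ⟩
    z + 5 * z                   ≡⟨ regroup′ z ⟩
    2 * 3 * z                   ∎
    where
    open ≤-Reasoning
    regroup : ∀ z → 2 + (2 * 3 + 2 * z + 3 * z) ≡ 8 + 5 * z
    regroup = solve-∀
    regroup′ : ∀ z → z + 5 * z ≡ 2 * 3 * z
    regroup′ = solve-∀

  Triple⇒product≤ : ∀ {s x y z} → 2 ≤ x * y → Triple s x y z → x * y * z ≤ suc (x * y + x * z + y * z)
  Triple⇒product≤ {s} {x} {y} {z} 2≤xy t = ≤-trans (∣⇒≤ {{>-nonZero shift≥1′}} (Triple.product∣ t)) (shift≤suc s _)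
    where
    shift≥1′ : 1 ≤ shift s (x * y + x * z + y * z)
    shift≥1′ = shift≥1 s (≤-trans 2≤xy (≤-trans (m≤m+n (x * y) (x * z)) (m≤m+n _ (y * z))))

  -- The bound leaves x = 2, y = 3, 3 < z ≤ 7. Only (2, 3, 5) with s = + and (2, 3, 7) with s = -
  -- pass the divisibility; they fail the condition on x, as shift + 15 = 14 and shift - 21 = 22.
  noSmallTriple : ∀ s z → 3 < z → z ≤ 7 → Triple s 2 3 z → ⊥
  noSmallTriple Sign.+ 4 _ _ t = from-no (24 ∣? 25) (Triple.product∣ t)
  noSmallTriple Sign.- 4 _ _ t = from-no (24 ∣? 27) (Triple.product∣ t)
  noSmallTriple Sign.+ 5 _ _ t = from-no (7 ∣? 2) (Triple.factors-x t 7 (from-yes (prime? 7)) (divides 2 refl))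
  noSmallTriple Sign.- 5 _ _ t = from-no (30 ∣? 32) (Triple.product∣ t)
  noSmallTriple Sign.+ 6 _ _ t = from-no (36 ∣? 35) (Triple.product∣ t)
  noSmallTriple Sign.- 6 _ _ t = from-no (36 ∣? 37) (Triple.product∣ t)
  noSmallTriple Sign.+ 7 _ _ t = from-no (42 ∣? 40) (Triple.product∣ t)
  noSmallTriple Sign.- 7 _ _ t = from-no (11 ∣? 2) (Triple.factors-x t 11 (from-yes (prime? 11)) (divides 2 refl))
  noSmallTriple _ (suc (suc (suc (suc (suc (suc (suc (suc _)))))))) _ (s≤s (s≤s (s≤s (s≤s (s≤s (s≤s (s≤s ()))))))) _
  noSmallTriple _ 0 () _ _
  noSmallTriple _ 1 (s≤s ()) _ _
  noSmallTriple _ 2 (s≤s (s≤s ())) _ _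
  noSmallTriple _ 3 (s≤s (s≤s (s≤s ()))) _ _

  -- No increasing triple 2 ≤ x < y < z satisfies the constraints: the size bound forces
  -- x = 2, y = 3 and z ≤ 7, and those cases are excluded by computation.
  noSortedTriple : ∀ {s x y z} → 2 ≤ x → x < y → y < z → Triple s x y z → ⊥
  noSortedTriple {s} {x} {y} {z} 2≤x x<y y<z t
    with Triple⇒product≤ (*-mono-≤ 2≤x (≤-trans (s≤s z≤n) x<y)) t | m≤n⇒m<n∨m≡n 2≤x
  ... | product≤ | inj₁ 3≤x = <⇒≱ (e₂+1<product-3≤x 3≤x x<y y<z) product≤
  ... | product≤ | inj₂ refl with m≤n⇒m<n∨m≡n x<y
  ...   | inj₁ 4≤y = <⇒≱ (e₂+1<product-4≤y 4≤y y<z) product≤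
  ...   | inj₂ refl with z ≤? 7
  ...     | no z≰7 = <⇒≱ (e₂+1<product-8≤z (≰⇒> z≰7)) product≤
  ...     | yes z≤7 = noSmallTriple s z y<z z≤7 t

  noTriple : ∀ {s x y z} → 2 ≤ x → 2 ≤ y → 2 ≤ z → x ≢ y → y ≢ z → x ≢ z → ¬ Triple s x y z
  noTriple {s} 2≤x 2≤y 2≤z x≢y y≢z x≢z = sort₃ (λ x y z → 2 ≤ x → 2 ≤ y → 2 ≤ z → ¬ Triple s x y z)
    (λ h 2≤y 2≤x 2≤z → h 2≤x 2≤y 2≤z ∘ swap₁₂)
    (λ h 2≤x 2≤z 2≤y → h 2≤x 2≤y 2≤z ∘ swap₂₃)
    (λ x<y y<z 2≤x _ _ → noSortedTriple 2≤x x<y y<z) x≢y y≢z x≢z 2≤x 2≤y 2≤z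

module ExceptionalSets {n} (p : Fin n → ℕ) (prime-p : ∀ i → Prime (p i))
                       (v : Fin n → ℕ) (v>0 : ∀ i → 0 < v i) (s : Sign) where

  open import Data.Nat
  open import Data.Nat.Properties
  open import Data.Nat.Divisibility
  open import Data.Nat.Primality using (prime⇒nonZero)
  import Data.Fin as Fin
  open import Data.Fin.Subset using (⊤; _∈_; _∉_; _-_)
  open import Data.Fin.Subset.Properties using (∈⊤; x∈p∧x≢y⇒x∈p-y; p─x─y≡p─y─x)
  open import Data.Product using (_,_)
  open import Data.Sum using (_⊎_; inj₁; inj₂)
  import Data.Sum as Sum
  open import Relation.Nullary using (yes; no)
  open import Function using (_∘_)
  open import Relation.Binary.PropositionalEquality
  open PrimeFactors
  open SignShift
  open SubsetProducts

  a : Fin n → ℕ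
  a i = p i ^ v i

  p∣a : ∀ i → p i ∣ a i
  p∣a i with v i | v>0 i
  ... | suc k | _ = m∣m*n (p i ^ k)

  a≥2 : ∀ i → 2 ≤ a i
  a≥2 i = ≤-trans (prime≥2 (prime-p i)) (∣⇒≤ {{m^n≢0 (p i) (v i) {{prime⇒nonZero (prime-p i)}}}} (p∣a i))

  a≥1 : ∀ i → 1 ≤ a i
  a≥1 i = ≤-trans (s≤s z≤n) (a≥2 i)

  N : Subset n → ℕ
  N I = prodOver I a

  Exceptional : Subset n → Set
  Exceptional I = PrimeFactorsIn (λ q → ∃ λ i → i ∉ I × q ≡ p i) (shift s (N I))

  N≥2 : ∀ {I : Subset n} {x} → x ∈ I → 2 ≤ N I
  N≥2 x∈I = ≤-trans (a≥2 _) (∈⇒≤prodOver a a≥1 x∈I)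

  -- A nonempty I either gives a prime factor of shift s (N I) outside {p i}, or is exceptional:
  -- a prime factor p i with i ∈ I would divide both N I and shift s (N I).
  newPrime⊎exceptional : ∀ {I : Subset n} {x} → x ∈ I →
    (∃ λ q → Prime q × (∀ i → q ≢ p i) × q ∣ shift s (N I)) ⊎ Exceptional I
  newPrime⊎exceptional {I} x∈I with newPrimeFactor? p (shift s (N I)) (shift≥1 s (N≥2 x∈I))
  ... | inj₁ new = inj₁ new
  ... | inj₂ old = inj₂ λ q prime-q q∣shift → outside q prime-q q∣shift (old q prime-q q∣shift)
    where
    outside : ∀ q → Prime q → q ∣ shift s (N I) → ∃ (λ i → q ≡ p i) → ∃ λ i → i ∉ I × q ≡ p i
    outside q prime-q q∣shift (i , refl) = i , (λ i∈I → prime∤1 prime-q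
      (∣-∧-∣shift⇒∣1 s (≤-trans (s≤s z≤n) (N≥2 x∈I)) (∣-trans (p∣a i) (∈⇒∣prodOver a i∈I)) q∣shift)) , refl

  ∉⊤-i : ∀ {x i : Fin n} → x ∉ ⊤ - i → x ≡ i
  ∉⊤-i = ∉-remove ∈⊤

  ∉⊤-i-j : ∀ {x i j : Fin n} → x ∉ ⊤ - i - j → x ≡ i ⊎ x ≡ j
  ∉⊤-i-j {x} {i} x∉ with x Fin.≟ i
  ... | yes x≡i = inj₁ x≡i
  ... | no x≢i = inj₂ (∉-remove (x∈p∧x≢y⇒x∈p-y ∈⊤ x≢i) x∉)

  ∈⊤-i-j : ∀ {x i j : Fin n} → x ≢ i → x ≢ j → x ∈ ⊤ - i - j
  ∈⊤-i-j x≢i x≢j = x∈p∧x≢y⇒x∈p-y (x∈p∧x≢y⇒x∈p-y ∈⊤ x≢i) x≢j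

  exceptional⇒power : ∀ {i : Fin n} → Exceptional (⊤ - i) → PrimeFactorsIn (_≡ p i) (shift s (N (⊤ - i)))
  exceptional⇒power exc q prime-q q∣shift with exc q prime-q q∣shift
  ... | x , x∉ , q≡px = trans q≡px (cong p (∉⊤-i x∉))

  exceptional⇒twoPrimes : ∀ {i j : Fin n} → Exceptional (⊤ - i - j) →
    PrimeFactorsIn (λ q → q ≡ p i ⊎ q ≡ p j) (shift s (N (⊤ - i - j)))
  exceptional⇒twoPrimes {i} {j} exc q prime-q q∣shift with exc q prime-q q∣shift
  ... | x , x∉ , q≡px = Sum.map (trans q≡px ∘ cong p) (trans q≡px ∘ cong p) (∉⊤-i-j {x} {i} {j} x∉)

  -- The pair bound for subsets: if ⊤ - i, ⊤ - j and the nonempty ⊤ - i - j are exceptional, then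
  -- N (⊤ - i - j) < a i * a j.  (Apply pairBound to Q = N (⊤ - i - j), using
  -- N (⊤ - i) = a j * Q and N (⊤ - j) = a i * Q.)
  pairBound-⊤ : ∀ {i j k : Fin n} → i ≢ j → k ∈ ⊤ - i - j →
    Exceptional (⊤ - i) → Exceptional (⊤ - j) → Exceptional (⊤ - i - j) → N (⊤ - i - j) < a i * a j
  pairBound-⊤ {i} {j} i≢j k∈ exc-i exc-j exc-ij =
    pairBound s (prime-p i) (prime-p j) (a≥2 i) (a≥2 j) (N≥2 k∈)
      (subst (λ m → PrimeFactorsIn (_≡ p i) (shift s m)) N-i≡ (exceptional⇒power exc-i))
      (subst (λ m → PrimeFactorsIn (_≡ p j) (shift s m)) N-j≡ (exceptional⇒power exc-j))
      (exceptional⇒twoPrimes exc-ij)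
    where
    N-i≡ : N (⊤ - i) ≡ a j * N (⊤ - i - j)
    N-i≡ = prodOver-remove a (x∈p∧x≢y⇒x∈p-y ∈⊤ (i≢j ∘ sym))
    N-j≡ : N (⊤ - j) ≡ a i * N (⊤ - i - j)
    N-j≡ = trans (prodOver-remove a (x∈p∧x≢y⇒x∈p-y ∈⊤ i≢j)) (cong (λ I → a i * N I) (p─x─y≡p─y─x ⊤ j i))

  -- If ⊤ - i is exceptional and a i < N (⊤ - i) = M, then a i divides shift s M (a power of
  -- p i of size at least a i), and every prime factor of shift s M divides a i.
  exceptional-⊤-i : ∀ {i : Fin n} {M} → Exceptional (⊤ - i) → N (⊤ - i) ≡ M → a i < M →
    a i ∣ shift s M × PrimeFactorsIn (_∣ a i) (shift s M)
  exceptional-⊤-i {i} exc refl a<N =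
    prime-power-≤⇒∣ (v i) (prime-p i) (shift≥1 s (≤-trans (a≥2 i) (<⇒≤ a<N))) (exceptional⇒power exc)
      (≤-trans (<⇒≤pred a<N) (∸1≤shift s _)) ,
    λ q prime-q q∣shift → subst (_∣ a i) (sym (exceptional⇒power exc q prime-q q∣shift)) (p∣a i)

-- For n ≥ 4 no family of exceptional sets ⊤ - i (i < 4), ⊤ - 0 - 1, ⊤ - 2 - 3 exists: the pair
-- bounds give a₀a₁ ≤ N (⊤ - 2 - 3) < a₂a₃ ≤ N (⊤ - 0 - 1) < a₀a₁.
module FourOrMore {m} (p : Fin (4 + m) → ℕ) (prime-p : ∀ i → Prime (p i))
                  (v : Fin (4 + m) → ℕ) (v>0 : ∀ i → 0 < v i) (s : Sign) where

  open import Data.Nat.Properties using (<-irrefl; module ≤-Reasoning)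
  open import Data.Nat using (_*_)
  open import Data.Fin.Patterns using (0F; 1F; 2F; 3F)
  open import Data.Fin.Subset using (⊤; _-_; _∈_)
  open import Data.Empty using (⊥)
  open import Relation.Binary.PropositionalEquality using (refl)
  open ExceptionalSets p prime-p v v>0 s
  open SubsetProducts

  noExceptionalFamily : Exceptional (⊤ - 0F) → Exceptional (⊤ - 1F) → Exceptional (⊤ - 2F) →
    Exceptional (⊤ - 3F) → Exceptional (⊤ - 0F - 1F) → Exceptional (⊤ - 2F - 3F) → ⊥
  noExceptionalFamily exc-0 exc-1 exc-2 exc-3 exc-01 exc-23 = <-irrefl refl (begin-strict
    a 0F * a 1F      ≤⟨ ∈∈⇒≤prodOver a a≥1 0∈⊤-2-3 1∈⊤-2-3 (λ ()) ⟩
    N (⊤ - 2F - 3F)  <⟨ pairBound-⊤ (λ ()) 0∈⊤-2-3 exc-2 exc-3 exc-23 ⟩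
    a 2F * a 3F      ≤⟨ ∈∈⇒≤prodOver a a≥1 2∈⊤-0-1 3∈⊤-0-1 (λ ()) ⟩
    N (⊤ - 0F - 1F)  <⟨ pairBound-⊤ (λ ()) 2∈⊤-0-1 exc-0 exc-1 exc-01 ⟩
    a 0F * a 1F      ∎)
    where
    open ≤-Reasoning
    0∈⊤-2-3 : 0F ∈ ⊤ - 2F - 3F
    1∈⊤-2-3 : 1F ∈ ⊤ - 2F - 3F
    2∈⊤-0-1 : 2F ∈ ⊤ - 0F - 1F
    3∈⊤-0-1 : 3F ∈ ⊤ - 0F - 1F
    0∈⊤-2-3 = ∈⊤-i-j {0F} {2F} {3F} (λ ()) (λ ())
    1∈⊤-2-3 = ∈⊤-i-j {1F} {2F} {3F} (λ ()) (λ ())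
    2∈⊤-0-1 = ∈⊤-i-j {2F} {0F} {1F} (λ ()) (λ ())
    3∈⊤-0-1 = ∈⊤-i-j {3F} {0F} {1F} (λ ()) (λ ())

-- For n = 3 the six exceptional sets ⊤ - i and ⊤ - i - j make (a₀, a₁, a₂) a Triple of distinct
-- numbers ≥ 2, which ThreeNumbers rules out.
module Three (p : Fin 3 → ℕ) (prime-p : ∀ i → Prime (p i)) (p-injective : Injective _≡_ _≡_ p)
             (v : Fin 3 → ℕ) (v>0 : ∀ i → 0 < v i) (s : Sign) where

  open import Data.Nat using (_*_)
  open import Data.Nat.Properties using (*-mono-≤; *-identityʳ)
  open import Data.Nat.Divisibility using (_∣_)
  open import Data.Nat.Primality using (euclidsLemma)
  open import Data.Nat.Coprimality using (Coprime)
  open import Data.Fin.Patterns using (0F; 1F; 2F)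
  open import Data.Fin.Subset using (⊤; _-_)
  open import Data.Product using (proj₁; proj₂)
  import Data.Sum as Sum
  open import Data.Empty using (⊥)
  open import Relation.Binary.PropositionalEquality using (sym; trans; cong; subst)
  open ExceptionalSets p prime-p v v>0 s
  open PrimeFactors
  open SignShift using (shift)
  open ThreeNumbers

  prime∣a⇒≡p : ∀ {q} i → Prime q → q ∣ a i → q ≡ p i
  prime∣a⇒≡p i prime-q = prime∣prime-power (v i) prime-q (prime-p i)

  a-injective : ∀ {i j} → i ≢ j → a i ≢ a j
  a-injective {i} {j} i≢j ai≡aj = i≢j (p-injective (prime∣a⇒≡p j (prime-p i) (subst (p i ∣_) ai≡aj (p∣a i))))

  samePrime⇒sameIndex : ∀ {q i j} → q ≡ p i → q ≡ p j → i ≡ j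
  samePrime⇒sameIndex q≡pi q≡pj = p-injective (trans (sym q≡pi) q≡pj)

  coprime-a : ∀ {i j} → i ≢ j → Coprime (a i) (a j)
  coprime-a {i} {j} i≢j = noCommonPrime⇒coprime (a≥1 i) λ q prime-q q∣ai q∣aj →
    i≢j (samePrime⇒sameIndex (prime∣a⇒≡p i prime-q q∣ai) (prime∣a⇒≡p j prime-q q∣aj))

  coprime-a*a : ∀ {i j k} → i ≢ k → j ≢ k → Coprime (a i * a j) (a k)
  coprime-a*a {i} {j} {k} i≢k j≢k = noCommonPrime⇒coprime (*-mono-≤ (a≥1 i) (a≥1 j)) λ q prime-q q∣aiaj q∣ak →
    Sum.[ (λ q∣ai → i≢k (samePrime⇒sameIndex (prime∣a⇒≡p i prime-q q∣ai) (prime∣a⇒≡p k prime-q q∣ak)))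
        , (λ q∣aj → j≢k (samePrime⇒sameIndex (prime∣a⇒≡p j prime-q q∣aj) (prime∣a⇒≡p k prime-q q∣ak))) ]
      (euclidsLemma (a i) (a j) prime-q q∣aiaj)

  -- In Fin 3 the products compute: N (⊤ - 0) = a₁ * (a₂ * 1) and N (⊤ - 1 - 2) = a₀ * 1, etc.
  -- Index i together with the pair bound for the other two indices j, k gives a i < a j * a k,
  -- so a i ∣ shift s (a j * a k) and all prime factors of shift s (a j * a k) divide a i.
  noExceptionalFamily : Exceptional (⊤ - 0F) → Exceptional (⊤ - 1F) → Exceptional (⊤ - 2F) →
    Exceptional (⊤ - 1F - 2F) → Exceptional (⊤ - 0F - 2F) → Exceptional (⊤ - 0F - 1F) → ⊥
  noExceptionalFamily exc-0 exc-1 exc-2 exc-12 exc-02 exc-01 =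
    noTriple {s} (a≥2 0F) (a≥2 1F) (a≥2 2F) (a-injective (λ ())) (a-injective (λ ())) (a-injective (λ ())) (record
      { product∣ = product∣shift-e₂ s (a≥1 0F) (a≥1 1F) (a≥1 2F) (coprime-a (λ ())) (coprime-a*a (λ ()) (λ ()))
                     (proj₁ index-0) (proj₁ index-1) (proj₁ index-2)
      ; factors-x = proj₂ index-0
      ; factors-y = proj₂ index-1
      ; factors-z = proj₂ index-2
      })
    where
    index-0 : a 0F ∣ shift s (a 1F * a 2F) × PrimeFactorsIn (_∣ a 0F) (shift s (a 1F * a 2F))
    index-0 = exceptional-⊤-i exc-0 (cong (a 1F *_) (*-identityʳ (a 2F)))
      (subst (_< a 1F * a 2F) (*-identityʳ (a 0F)) (pairBound-⊤ (λ ()) (∈⊤-i-j {0F} {1F} {2F} (λ ()) (λ ())) exc-1 exc-2 exc-12))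
    index-1 : a 1F ∣ shift s (a 0F * a 2F) × PrimeFactorsIn (_∣ a 1F) (shift s (a 0F * a 2F))
    index-1 = exceptional-⊤-i exc-1 (cong (a 0F *_) (*-identityʳ (a 2F)))
      (subst (_< a 0F * a 2F) (*-identityʳ (a 1F)) (pairBound-⊤ (λ ()) (∈⊤-i-j {1F} {0F} {2F} (λ ()) (λ ())) exc-0 exc-2 exc-02))
    index-2 : a 2F ∣ shift s (a 0F * a 1F) × PrimeFactorsIn (_∣ a 2F) (shift s (a 0F * a 1F))
    index-2 = exceptional-⊤-i exc-2 (cong (a 0F *_) (*-identityʳ (a 1F)))
      (subst (_< a 0F * a 1F) (*-identityʳ (a 2F)) (pairBound-⊤ (λ ()) (∈⊤-i-j {2F} {0F} {1F} (λ ()) (λ ())) exc-0 exc-1 exc-01))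

module Conclusion {n} (p : Fin n → ℕ) (prime-p : ∀ i → Prime (p i)) (v : Fin n → ℕ) (v>0 : ∀ i → 0 < v i)
                  (D : Subset n → Set) (D₀⊆D : ∀ I → D0 I → D I)
                  (ε : Subset n → Sign) (s : Sign) (ε≡s : ∀ I → D0 I → ε I ≡ s) where

  open import Data.Nat using (s≤s; z≤n)
  open import Data.Nat.Properties using (≤-trans)
  import Data.Nat.Divisibility as ℕ
  import Data.Integer as ℤ
  import Data.Integer.Divisibility as ℤ
  open import Data.Fin.Subset using (⊤; _-_; _∈_)
  open import Data.Fin.Subset.Properties using (∈⊤; x∈p∧x≢y⇒x∈p-y)
  open import Data.Product using (_,_)
  open import Data.Sum using (inj₁; inj₂)
  open import Relation.Binary.PropositionalEquality using (sym; subst)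
  open ExceptionalSets p prime-p v v>0 s
  open SignShift
  open SubsetProducts

  NewPrimeDivisor : Set
  NewPrimeDivisor = ∃ λ q → Prime q × (∀ i → q ≢ p i) ×
    ∃ λ I → D I × (ℤ.+ q) ℤ.∣ (ℤ.+ prodOver I (λ i → p i ^ v i) ℤ.- (ε I ℤ.◃ 1))

  settle : ∀ I {x} → D0 I → x ∈ I → (Exceptional I → NewPrimeDivisor) → NewPrimeDivisor
  settle I d0 x∈I continue with newPrime⊎exceptional x∈I
  ... | inj₂ exc = continue exc
  ... | inj₁ (q , prime-q , q≢p , q∣shift) = q , prime-q , q≢p , I , D₀⊆D I d0 , q∣N-ε
    where
    q∣N-ε : (ℤ.+ q) ℤ.∣ (ℤ.+ N I ℤ.- (ε I ℤ.◃ 1))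
    q∣N-ε rewrite ε≡s I d0 = subst (q ℕ.∣_) (sym (∣-∣≡shift s (N I) (≤-trans (s≤s z≤n) (N≥2 x∈I)))) q∣shift

  settle-⊤-i : ∀ i {x} → x ≢ i → (Exceptional (⊤ - i) → NewPrimeDivisor) → NewPrimeDivisor
  settle-⊤-i i x≢i = settle (⊤ - i) (inj₂ (inj₂ (∣⊤-i∣ i))) (x∈p∧x≢y⇒x∈p-y ∈⊤ x≢i)

  settle-⊤-i-j : ∀ i j {x} → i ≢ j → x ≢ i → x ≢ j → (Exceptional (⊤ - i - j) → NewPrimeDivisor) → NewPrimeDivisor
  settle-⊤-i-j i j i≢j x≢i x≢j = settle (⊤ - i - j) (inj₂ (inj₁ (∣⊤-i-j∣ i≢j))) (∈⊤-i-j x≢i x≢j)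

open import Data.Nat using (suc; s≤s)
open import Data.Integer using (+_; _-_; _◃_)
open import Data.Integer.Divisibility using (_∣_)
open import Data.Product using (_,_)
open import Data.Empty using (⊥-elim)
open import Data.Fin.Patterns using (0F; 1F; 2F; 3F)

-- Assume every relevant set of 𝒟₀ is exceptional (otherwise settle produces the prime) and reach
-- a contradiction: for n = 3 with the six sets ⊤ - i, ⊤ - i - j, for n ≥ 4 with ⊤ - i (i < 4),
-- ⊤ - 0 - 1 and ⊤ - 2 - 3.
theorem1 : (n : ℕ) → 3 ≤ n →
    (p : Fin n → ℕ) → (∀ i → Prime (p i)) → Injective _≡_ _≡_ p →
    (v : Fin n → ℕ) → (∀ i → 0 < v i) →
    (D : Subset n → Set) → (∀ I → D I → Pstar I) → (∀ I → D0 I → D I) →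
    (ε : Subset n → Sign) → (∃ λ s → ∀ I → D0 I → ε I ≡ s) →
    ∃ λ (q : ℕ) → Prime q × (∀ i → q ≢ p i) ×
      ∃ λ (I : Subset n) → D I ×
        (+ q) ∣ (+ prodOver I (λ i → p i ^ v i) - (ε I ◃ 1))
theorem1 3 _ p prime-p p-injective v v>0 D _ D₀⊆D ε (s , ε≡s) =
  settle-⊤-i 0F {1F} (λ ()) λ exc-0 →
  settle-⊤-i 1F {0F} (λ ()) λ exc-1 →
  settle-⊤-i 2F {0F} (λ ()) λ exc-2 →
  settle-⊤-i-j 1F 2F {0F} (λ ()) (λ ()) (λ ()) λ exc-12 →
  settle-⊤-i-j 0F 2F {1F} (λ ()) (λ ()) (λ ()) λ exc-02 →
  settle-⊤-i-j 0F 1F {2F} (λ ()) (λ ()) (λ ()) λ exc-01 →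
  ⊥-elim (Three.noExceptionalFamily p prime-p p-injective v v>0 s exc-0 exc-1 exc-2 exc-12 exc-02 exc-01)
  where open Conclusion p prime-p v v>0 D D₀⊆D ε s ε≡s
theorem1 (suc (suc (suc (suc m)))) _ p prime-p _ v v>0 D _ D₀⊆D ε (s , ε≡s) =
  settle-⊤-i 0F {1F} (λ ()) λ exc-0 →
  settle-⊤-i 1F {0F} (λ ()) λ exc-1 →
  settle-⊤-i 2F {0F} (λ ()) λ exc-2 →
  settle-⊤-i 3F {0F} (λ ()) λ exc-3 →
  settle-⊤-i-j 0F 1F {2F} (λ ()) (λ ()) (λ ()) λ exc-01 →
  settle-⊤-i-j 2F 3F {0F} (λ ()) (λ ()) (λ ()) λ exc-23 →
  ⊥-elim (FourOrMore.noExceptionalFamily p prime-p v v>0 s exc-0 exc-1 exc-2 exc-3 exc-01 exc-23)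
  where open Conclusion p prime-p v v>0 D D₀⊆D ε s ε≡s
theorem1 1 (s≤s ()) _ _ _ _ _ _ _ _ _ _
theorem1 2 (s≤s (s≤s ())) _ _ _ _ _ _ _ _ _ _
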